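{- Let $G$ be a connected undirected unweighted multigraph on $n$ vertices with minimum cut value $\lambda$, and let $p\in(0,1)$ with $p^\lambda<n^{ -1000}$. Let $z'_G(p)=\sum_{C:|C|<1.1\lambda}p^{|C|}$. Then $z'_G(p)\ge(1-O(1/n))\,z_G(p)$.
   Context: A cut is the set of edges crossing a bipartition $\{S,V\setminus S\}$ with $\emptyset\ne S\subsetneq V$; $|C|$ is its number of edges; $z_G(p)=\sum_C p^{|C|}$ over all cuts.
   Formalization: The parameter p ranges over the rationals in the interval $(0,1)$. -}

module Defs where

open import Data.Nat using (ℕ; zero; suc; _<ᵇ_; _≤_)
import Data.Nat as ℕ
open import Data.Bool using (Bool; true; false; if_then_else_; _∧_; _xor_; not)
open import Data.Fin using (Fin)
open import Data.Vec using (Vec; []; _∷_; lookup)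
open import Data.List using (List; []; _∷_; _++_; map; length; filterᵇ)
open import Data.List.Membership.Propositional using (_∈_)
open import Data.Product using (_×_; _,_; Σ; ∃; proj₁; proj₂)
open import Data.Rational using (ℚ; 0ℚ; 1ℚ; _*_; _+_)
open import Relation.Binary.PropositionalEquality using (_≡_)

-- A finite undirected multigraph on vertex set Fin n: a list of edges
-- (each undirected edge stored in an arbitrary orientation; parallel edges
-- and loops allowed).
record Multigraph (n : ℕ) : Set where
  constructor mkGraph
  field
    edges : List (Fin n × Fin n)
open Multigraph public

data Reach {n : ℕ} (G : Multigraph n) : Fin n → Fin n → Set where
  here  : ∀ {u} → Reach G u u
  stepF : ∀ {u v w} → (u , v) ∈ edges G → Reach G v w → Reach G u w
  stepB : ∀ {u v w} → (v , u) ∈ edges G → Reach G v w → Reach G u w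

Connected : ∀ {n} → Multigraph n → Set
Connected {n} G = (u v : Fin n) → Reach G u v

allVecs : (m : ℕ) → List (Vec Bool m)
allVecs zero = [] ∷ []
allVecs (suc m) = map (true ∷_) (allVecs m) ++ map (false ∷_) (allVecs m)

allTrue : ∀ {m} → Vec Bool m → Bool
allTrue [] = true
allTrue (b ∷ v) = b ∧ allTrue v

-- Cuts = bipartitions {S, V∖S} with ∅ ≠ S ⊊ V.  Each unordered bipartition is
-- represented exactly once, by the side S containing vertex 0 (S ≠ V).
cutSides : (n : ℕ) → List (Vec Bool n)
cutSides zero = []
cutSides (suc m) = map (true ∷_) (filterᵇ (λ v → not (allTrue v)) (allVecs m))

cutSize : ∀ {n} → Multigraph n → Vec Bool n → ℕ
cutSize G S = length (filterᵇ (λ e → lookup S (proj₁ e) xor lookup S (proj₂ e)) (edges G))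

IsMinCut : ∀ {n} → Multigraph n → ℕ → Set
IsMinCut {n} G λ′ =
  (Σ (Vec Bool n) λ S → S ∈ cutSides n × cutSize G S ≡ λ′) ×
  (∀ S → S ∈ cutSides n → λ′ ≤ cutSize G S)

_^ℚ_ : ℚ → ℕ → ℚ
p ^ℚ zero = 1ℚ
p ^ℚ suc k = p * (p ^ℚ k)

sumℚ : List ℚ → ℚ
sumℚ [] = 0ℚ
sumℚ (x ∷ xs) = x + sumℚ xs

z : ∀ {n} → Multigraph n → ℚ → ℚ
z {n} G p = sumℚ (map (λ S → p ^ℚ cutSize G S) (cutSides n))

-- z'_G(p) = Σ_{C : |C| < 1.1 λ} p^{|C|};  |C| < 1.1λ  ⇔  10·|C| < 11·λ.
z′ : ∀ {n} → Multigraph n → ℕ → ℚ → ℚ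
z′ {n} G λ′ p =
  sumℚ (map (λ S → p ^ℚ cutSize G S)
            (filterᵇ (λ S → 10 ℕ.* cutSize G S <ᵇ 11 ℕ.* λ′) (cutSides n)))

module Submission where

-- Karger's contraction bound, by double counting instead of random contraction.  If every cut of G
-- has at least λ edges, then G has at least nλ/2 links (non-loop edges), and the vertex sets S with
-- 2|δS| ≤ tλ that leave a link uv uncut are exactly the small sets of G/uv.  Averaging over the
-- links, the number of small sets grows by at most a factor n/(n − t) per contraction, so there
-- are at most 2^(t+1) n^t of them.  A cut C with |C| ≥ 1.1λ and level
-- v = ⌊2(|C| − λ)/λ⌋ has p^|C| ≤ p^λ n^-(9+3v), because p^λ < n^-1000, and at most n^(2v+7)
-- cuts have level ≤ v; so the cuts of size ≥ 1.1λ weigh at most p^λ Σ_v n^-(2+v) ≤ p^λ/n ≤ z/n.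

open import Algebra.Bundles using (CommutativeSemiring; CommutativeRing)
open import Defs

module ListSum {c ℓ} (R : CommutativeSemiring c ℓ) where
  open import Data.Bool using (Bool; true; false; not; T)
  open import Data.List using (List; []; _∷_; _++_; map; filterᵇ)
  open import Function using (_∘_)
  open import Level using (Level)
  open import Relation.Binary.Core using (Rel; _Preserves₂_⟶_⟶_)
  open import Relation.Binary.PropositionalEquality as ≡ using (_≡_)
  open CommutativeSemiring R
  open import Algebra.Properties.CommutativeSemigroup +-commutativeSemigroup using (interchange; x∙yz≈y∙xz)
  open import Relation.Binary.Reasoning.Setoid setoid

  private variable
    a b : Level
    A B : Set a

  ∑ : List A → (A → Carrier) → Carrier
  ∑ [] f = 0#
  ∑ (x ∷ xs) f = f x + ∑ xs f

  infix 5 ∑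
  syntax ∑ xs (λ x → e) = ∑[ x ∈ xs ] e

  ∑-cong : ∀ (xs : List A) {f g} → (∀ x → f x ≈ g x) → ∑ xs f ≈ ∑ xs g
  ∑-cong [] f≈g = refl
  ∑-cong (x ∷ xs) f≈g = +-cong (f≈g x) (∑-cong xs f≈g)

  ∑-++ : ∀ (xs ys : List A) f → ∑ (xs ++ ys) f ≈ ∑ xs f + ∑ ys f
  ∑-++ [] ys f = sym (+-identityˡ _)
  ∑-++ (x ∷ xs) ys f = trans (+-congˡ (∑-++ xs ys f)) (sym (+-assoc _ _ _))

  ∑-map : ∀ (g : A → B) (xs : List A) f → ∑ (map g xs) f ≡ ∑ xs (f ∘ g)
  ∑-map g [] f = ≡.refl
  ∑-map g (x ∷ xs) f = ≡.cong (f (g x) +_) (∑-map g xs f)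

  ∑-zero : ∀ (xs : List A) → ∑[ x ∈ xs ] 0# ≈ 0#
  ∑-zero [] = refl
  ∑-zero (x ∷ xs) = trans (+-identityˡ _) (∑-zero xs)

  ∑-distrib-+ : ∀ (xs : List A) f g → ∑[ x ∈ xs ] (f x + g x) ≈ ∑ xs f + ∑ xs g
  ∑-distrib-+ [] f g = sym (+-identityˡ 0#)
  ∑-distrib-+ (x ∷ xs) f g = trans (+-congˡ (∑-distrib-+ xs f g)) (interchange _ _ _ _)

  *-distribˡ-∑ : ∀ c (xs : List A) f → c * ∑ xs f ≈ ∑[ x ∈ xs ] (c * f x)
  *-distribˡ-∑ c [] f = zeroʳ c
  *-distribˡ-∑ c (x ∷ xs) f = trans (distribˡ c _ _) (+-congˡ (*-distribˡ-∑ c xs f))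

  *-distribʳ-∑ : ∀ c (xs : List A) f → ∑ xs f * c ≈ ∑[ x ∈ xs ] (f x * c)
  *-distribʳ-∑ c [] f = zeroˡ c
  *-distribʳ-∑ c (x ∷ xs) f = trans (distribʳ c _ _) (+-congˡ (*-distribʳ-∑ c xs f))

  ∑-comm : ∀ (xs : List A) (ys : List B) (f : A → B → Carrier) →
           ∑[ x ∈ xs ] ∑[ y ∈ ys ] f x y ≈ ∑[ y ∈ ys ] ∑[ x ∈ xs ] f x y
  ∑-comm [] ys f = sym (∑-zero ys)
  ∑-comm (x ∷ xs) ys f = begin
    ∑ ys (f x) + (∑[ x′ ∈ xs ] ∑[ y ∈ ys ] f x′ y) ≈⟨ +-congˡ (∑-comm xs ys f) ⟩
    ∑ ys (f x) + (∑[ y ∈ ys ] ∑[ x′ ∈ xs ] f x′ y) ≈⟨ sym (∑-distrib-+ ys (f x) _) ⟩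
    ∑[ y ∈ ys ] (f x y + (∑[ x′ ∈ xs ] f x′ y))  ∎

  ∑-partition : ∀ (P : A → Bool) (xs : List A) f →
                ∑ xs f ≈ ∑ (filterᵇ P xs) f + ∑ (filterᵇ (not ∘ P) xs) f
  ∑-partition P [] f = sym (+-identityˡ 0#)
  ∑-partition P (x ∷ xs) f with P x
  ... | true  = trans (+-congˡ (∑-partition P xs f)) (sym (+-assoc _ _ _))
  ... | false = trans (+-congˡ (∑-partition P xs f)) (x∙yz≈y∙xz _ _ _)

  module Ordered {ℓ′} {_≤_ : Rel Carrier ℓ′} (0≤0 : 0# ≤ 0#)
           (+-mono-≤ : _+_ Preserves₂ _≤_ ⟶ _≤_ ⟶ _≤_) where

    ∑-mono : ∀ (xs : List A) {f g} → (∀ x → f x ≤ g x) → ∑ xs f ≤ ∑ xs g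
    ∑-mono [] f≤g = 0≤0
    ∑-mono (x ∷ xs) f≤g = +-mono-≤ (f≤g x) (∑-mono xs f≤g)

    ∑-mono-filterᵇ : ∀ (P : A → Bool) (xs : List A) {f g} → (∀ x → T (P x) → f x ≤ g x) →
                     ∑ (filterᵇ P xs) f ≤ ∑ (filterᵇ P xs) g
    ∑-mono-filterᵇ P [] f≤g = 0≤0
    ∑-mono-filterᵇ P (x ∷ xs) f≤g with P x in Px
    ... | true  = +-mono-≤ (f≤g x (≡.subst T (≡.sym Px) _)) (∑-mono-filterᵇ P xs f≤g)
    ... | false = ∑-mono-filterᵇ P xs f≤g


module CutCounting where
  open import Data.Bool using (Bool; true; false; not; _∧_; _xor_; T)
  open import Data.Bool.Properties using (xor-same; T-≡)
  open import Data.Fin using (Fin; zero; suc; _≟_; punchOut; punchIn)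
  open import Data.Fin.Properties using (punchIn-punchOut)
  open import Data.List using (List; []; _∷_; _++_; map; length; filterᵇ; allFin)
  open import Data.List.Properties using (map-tabulate; length-tabulate; length-++; length-map)
  open import Data.List.Membership.Propositional using (_∈_)
  open import Data.List.Membership.Propositional.Properties using (∈-map⁺; ∈-filter⁺; ∈-++⁺ˡ; ∈-++⁺ʳ)
  open import Data.List.Relation.Unary.Any using (here)
  open import Data.Nat using (ℕ; zero; suc; _+_; _*_; _∸_; _^_; _≤_; _<_; _≤ᵇ_; _<ᵇ_; z≤n; s≤s;
                              NonZero; >-nonZero; >-nonZero⁻¹)
  open import Data.Nat.DivMod using (_/_; _%_; m≡m%n+[m/n]*n; m%n<n; m/n*n≤m; m/n≤m)
  open import Data.Nat.Properties hiding (_≟_)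
  open import Data.Nat.Tactic.RingSolver using (solve-∀)
  open import Data.Product using (_×_; _,_; ∃; proj₁; proj₂)
  open import Data.Vec using (Vec; []; _∷_; lookup; tabulate; insertAt)
  import Data.Vec as Vec
  open import Data.Vec.Properties using (lookup-map; lookup∘tabulate; insertAt-lookup; insertAt-punchIn)
  open import Function using (_∘_; id; flip)
  open import Function.Bundles using (Equivalence)
  open import Relation.Binary.PropositionalEquality
  open import Relation.Nullary using (does; yes; no)
  open import Relation.Nullary.Decidable using (dec-true; T?)

  open ListSum +-*-commutativeSemiring public
  open Ordered {_≤_ = _≤_} ≤-refl +-mono-≤ public

  fromBool : Bool → ℕ
  fromBool true = 1
  fromBool false = 0

  fromBool-T : ∀ {b} → T b → fromBool b ≡ 1
  fromBool-T {true} _ = refl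

  fromBool-mono : ∀ {a b} → (T a → T b) → fromBool a ≤ fromBool b
  fromBool-mono {false} _ = z≤n
  fromBool-mono {true} a⇒b rewrite fromBool-T (a⇒b _) = ≤-refl

  length-filterᵇ : ∀ {A : Set} (P : A → Bool) xs → length (filterᵇ P xs) ≡ ∑[ x ∈ xs ] fromBool (P x)
  length-filterᵇ P [] = refl
  length-filterᵇ P (x ∷ xs) with P x
  ... | true  = cong suc (length-filterᵇ P xs)
  ... | false = length-filterᵇ P xs

  module _ {n : ℕ} where

    crosses : Vec Bool n → Fin n × Fin n → Bool
    crosses S e = lookup S (proj₁ e) xor lookup S (proj₂ e)

    cutSize≡∑ : ∀ (G : Multigraph n) S → cutSize G S ≡ ∑[ e ∈ edges G ] fromBool (crosses S e)
    cutSize≡∑ G S = length-filterᵇ (crosses S) (edges G)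

    complement : Vec Bool n → Vec Bool n
    complement = Vec.map not

    crosses-complement : ∀ S e → crosses (complement S) e ≡ crosses S e
    crosses-complement S (u , v) rewrite lookup-map u not S | lookup-map v not S
      with lookup S u | lookup S v
    ... | true  | true  = refl
    ... | true  | false = refl
    ... | false | true  = refl
    ... | false | false = refl

    cutSize-complement : ∀ (G : Multigraph n) S → cutSize G (complement S) ≡ cutSize G S
    cutSize-complement G S = begin
      cutSize G (complement S)
        ≡⟨ cutSize≡∑ G (complement S) ⟩
      ∑[ e ∈ edges G ] fromBool (crosses (complement S) e)
        ≡⟨ ∑-cong (edges G) (cong fromBool ∘ crosses-complement S) ⟩
      ∑[ e ∈ edges G ] fromBool (crosses S e)
        ≡⟨ cutSize≡∑ G S ⟨
      cutSize G S ∎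
      where open ≡-Reasoning

    Nontrivial : Vec Bool n → Set
    Nontrivial S = (∃ λ i → lookup S i ≡ true) × (∃ λ j → lookup S j ≡ false)

    CutsAtLeast : Multigraph n → ℕ → Set
    CutsAtLeast G l = ∀ S → Nontrivial S → l ≤ cutSize G S

  allVecs-complete : ∀ {m} (S : Vec Bool m) → S ∈ allVecs m
  allVecs-complete [] = here refl
  allVecs-complete {suc m} (true ∷ S) = ∈-++⁺ˡ (∈-map⁺ (true ∷_) (allVecs-complete S))
  allVecs-complete {suc m} (false ∷ S) =
    ∈-++⁺ʳ (map (true ∷_) (allVecs m)) (∈-map⁺ (false ∷_) (allVecs-complete S))

  allTrue-false : ∀ {m} (S : Vec Bool m) j → lookup S j ≡ false → allTrue S ≡ false
  allTrue-false (true ∷ S) (suc j) Sj≡false = allTrue-false S j Sj≡false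
  allTrue-false (false ∷ S) _ _ = refl

  true∷-∈-cutSides : ∀ {m} (S : Vec Bool m) j → lookup S j ≡ false → (true ∷ S) ∈ cutSides (suc m)
  true∷-∈-cutSides S j Sj≡false =
    ∈-map⁺ (true ∷_) (∈-filter⁺ (T? ∘ _) (allVecs-complete S)
                                (subst (T ∘ not) (sym (allTrue-false S j Sj≡false)) _))

  cutsAtLeast : ∀ {m l} (G : Multigraph (suc m)) →
                (∀ S → S ∈ cutSides (suc m) → l ≤ cutSize G S) → CutsAtLeast G l
  cutsAtLeast G bound (true ∷ S) (_ , (suc j , Sj≡false)) = bound _ (true∷-∈-cutSides S j Sj≡false)
  cutsAtLeast G bound (true ∷ S) (_ , (zero , ()))
  cutsAtLeast G bound (false ∷ S) ((zero , ()) , _)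
  cutsAtLeast G bound (false ∷ S) ((suc i , Si≡true) , _) =
    subst (_ ≤_) (cutSize-complement G (false ∷ S))
      (bound _ (true∷-∈-cutSides (complement S) i (trans (lookup-map i not S) (cong not Si≡true))))

  module _ {n : ℕ} where

    isLink : Fin n × Fin n → Bool
    isLink e = not (does (proj₁ e ≟ proj₂ e))

    linkCount : Multigraph n → ℕ
    linkCount G = ∑[ e ∈ edges G ] fromBool (isLink e)

    uncutLinks : Multigraph n → Vec Bool n → ℕ
    uncutLinks G S = ∑[ e ∈ edges G ] fromBool (isLink e ∧ not (crosses S e))

    -- A loop never crosses a cut.
    uncut+cut≡link : ∀ S e → fromBool (isLink e ∧ not (crosses S e)) + fromBool (crosses S e) ≡ fromBool (isLink e)
    uncut+cut≡link S (u , v) with u ≟ v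
    ... | yes refl rewrite xor-same (lookup S u) = refl
    ... | no _ with crosses S (u , v)
    ...   | true  = refl
    ...   | false = refl

    uncutLinks+cutSize : ∀ (G : Multigraph n) S → uncutLinks G S + cutSize G S ≡ linkCount G
    uncutLinks+cutSize G S = begin
      uncutLinks G S + cutSize G S
        ≡⟨ cong (uncutLinks G S +_) (cutSize≡∑ G S) ⟩
      uncutLinks G S + (∑[ e ∈ edges G ] fromBool (crosses S e))
        ≡⟨ ∑-distrib-+ (edges G) _ _ ⟨
      ∑[ e ∈ edges G ] (fromBool (isLink e ∧ not (crosses S e)) + fromBool (crosses S e))
        ≡⟨ ∑-cong (edges G) (uncut+cut≡link S) ⟩
      linkCount G ∎
      where open ≡-Reasoning

  ∑-allFin-suc : ∀ {n} f → ∑ (allFin (suc n)) f ≡ f zero + ∑ (allFin n) (f ∘ suc)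
  ∑-allFin-suc {n} f = cong (f zero +_)
    (trans (cong (λ vs → ∑ vs f) (sym (map-tabulate id suc))) (∑-map suc (allFin n) f))

  ∑-≟ : ∀ {n} (y : Fin n) → ∑[ v ∈ allFin n ] fromBool (does (y ≟ v)) ≡ 1
  ∑-≟ {suc n} zero = trans (∑-allFin-suc {n} (λ v → fromBool (does (zero ≟ v)))) (cong suc (∑-zero (allFin n)))
  ∑-≟ {suc n} (suc y) = trans (∑-allFin-suc {n} (λ v → fromBool (does (suc y ≟ v)))) (∑-≟ y)

  singleton : ∀ {n} → Fin n → Vec Bool n
  singleton v = tabulate (λ x → does (x ≟ v))

  separated : ∀ {n} (x y v : Fin n) → ℕ
  separated x y v = fromBool (does (x ≟ v) xor does (y ≟ v))

  singleton-crossings : ∀ {n} (x y : Fin n) → ∑ (allFin n) (separated x y) ≡ 2 * fromBool (isLink (x , y))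
  singleton-crossings {suc n} zero zero = trans (∑-allFin-suc {n} (separated zero zero)) (∑-zero (allFin n))
  singleton-crossings {suc n} zero (suc y) = trans (∑-allFin-suc {n} (separated zero (suc y))) (cong suc (∑-≟ y))
  singleton-crossings {suc n} (suc x) zero = trans (∑-allFin-suc {n} (separated (suc x) zero))
    (cong suc (trans (∑-cong (allFin n) (λ v → cong fromBool (xor-false (does (x ≟ v))))) (∑-≟ x)))
    where xor-false : ∀ b → b xor false ≡ b
          xor-false true  = refl
          xor-false false = refl
  singleton-crossings {suc n} (suc x) (suc y) = trans (∑-allFin-suc {n} (separated (suc x) (suc y))) (singleton-crossings x y)

  crosses-singleton : ∀ {n} (v : Fin n) e → crosses (singleton v) e ≡ does (proj₁ e ≟ v) xor does (proj₂ e ≟ v)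
  crosses-singleton v (x , y) = cong₂ _xor_ (lookup∘tabulate _ x) (lookup∘tabulate _ y)

  handshake : ∀ {n} (G : Multigraph n) → ∑[ v ∈ allFin n ] cutSize G (singleton v) ≡ 2 * linkCount G
  handshake {n} G = begin
    ∑[ v ∈ allFin n ] cutSize G (singleton v)
      ≡⟨ ∑-cong (allFin n) (cutSize≡∑ G ∘ singleton) ⟩
    ∑[ v ∈ allFin n ] ∑[ e ∈ edges G ] fromBool (crosses (singleton v) e)
      ≡⟨ ∑-comm (allFin n) (edges G) _ ⟩
    ∑[ e ∈ edges G ] ∑[ v ∈ allFin n ] fromBool (crosses (singleton v) e)
      ≡⟨ ∑-cong (edges G) (λ e → trans (∑-cong (allFin n) (cong fromBool ∘ flip crosses-singleton e))
                                        (singleton-crossings (proj₁ e) (proj₂ e))) ⟩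
    ∑[ e ∈ edges G ] 2 * fromBool (isLink e)
      ≡⟨ *-distribˡ-∑ 2 (edges G) _ ⟨
    2 * linkCount G ∎
    where open ≡-Reasoning

  singleton-nontrivial : ∀ {n} (v : Fin (suc (suc n))) → Nontrivial (singleton v)
  singleton-nontrivial {n} v = (v , trans (lookup∘tabulate (λ x → does (x ≟ v)) v) (dec-true (v ≟ v) refl)) , other v
    where
    other : ∀ v → ∃ λ j → lookup (singleton {suc (suc n)} v) j ≡ false
    other zero    = suc zero , lookup∘tabulate {n = suc (suc n)} (λ x → does (x ≟ zero)) (suc zero)
    other (suc v) = zero , lookup∘tabulate (λ x → does (x ≟ suc v)) zero

  ∑-const : ∀ {A : Set} (xs : List A) c → ∑[ x ∈ xs ] c ≡ length xs * c
  ∑-const [] c = refl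
  ∑-const (x ∷ xs) c = cong (c +_) (∑-const xs c)

  degree-bound : ∀ {n l} (G : Multigraph (suc (suc n))) → CutsAtLeast G l → suc (suc n) * l ≤ 2 * linkCount G
  degree-bound {n} {l} G cuts≥l = begin
    suc (suc n) * l
      ≡⟨ cong (_* l) (length-tabulate {n = suc (suc n)} id) ⟨
    length (allFin (suc (suc n))) * l
      ≡⟨ ∑-const (allFin (suc (suc n))) l ⟨
    ∑[ v ∈ allFin (suc (suc n)) ] l
      ≤⟨ ∑-mono (allFin _) (λ v → cuts≥l (singleton v) (singleton-nontrivial v)) ⟩
    ∑[ v ∈ allFin (suc (suc n)) ] cutSize G (singleton v)
      ≡⟨ handshake G ⟩
    2 * linkCount G ∎
    where open ≤-Reasoning

  ∑-allVecs-suc : ∀ n h →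
    ∑ (allVecs (suc n)) h ≡ ∑ (allVecs n) (h ∘ (true ∷_)) + ∑ (allVecs n) (h ∘ (false ∷_))
  ∑-allVecs-suc n h = trans (∑-++ (map (true ∷_) (allVecs n)) _ h)
    (cong₂ _+_ (∑-map (true ∷_) (allVecs n) h) (∑-map (false ∷_) (allVecs n) h))

  ∑-allVecs-insertAt : ∀ n (i : Fin (suc n)) h →
    ∑ (allVecs (suc n)) h ≡ ∑[ T ∈ allVecs n ] (h (insertAt T i true) + h (insertAt T i false))
  ∑-allVecs-insertAt n zero h = trans (∑-allVecs-suc n h) (sym (∑-distrib-+ (allVecs n) _ _))
  ∑-allVecs-insertAt (suc n) (suc i) h = begin
    ∑ (allVecs (suc (suc n))) h
      ≡⟨ ∑-allVecs-suc (suc n) h ⟩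
    ∑ (allVecs (suc n)) (h ∘ (true ∷_)) + ∑ (allVecs (suc n)) (h ∘ (false ∷_))
      ≡⟨ cong₂ _+_ (∑-allVecs-insertAt n i (h ∘ (true ∷_))) (∑-allVecs-insertAt n i (h ∘ (false ∷_))) ⟩
    (∑[ T ∈ allVecs n ] (h (true ∷ insertAt T i true) + h (true ∷ insertAt T i false)))
      + (∑[ T ∈ allVecs n ] (h (false ∷ insertAt T i true) + h (false ∷ insertAt T i false)))
      ≡⟨ ∑-allVecs-suc n _ ⟨
    ∑[ T ∈ allVecs (suc n) ] (h (insertAt T (suc i) true) + h (insertAt T (suc i) false)) ∎
    where open ≡-Reasoning

  module _ {n : ℕ} where

    isSmallCut : Multigraph n → ℕ → Vec Bool n → Bool
    isSmallCut H c S = 2 * cutSize H S ≤ᵇ c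

    -- Counts vertex sets: each cut twice (S and its complement), and also ∅ and V.
    smallCutCount : Multigraph n → ℕ → ℕ
    smallCutCount H c = ∑[ S ∈ allVecs n ] fromBool (isSmallCut H c S)

    isNearMinCut : Multigraph n → ℕ → Vec Bool n → Bool
    isNearMinCut G l S = 10 * cutSize G S <ᵇ 11 * l

  -- Contracting ab merges b into a, which is called a′ in the contracted graph.
  module Contraction {n : ℕ} {a b : Fin (suc n)} (b≢a : b ≢ a) where

    a′ : Fin n
    a′ = punchOut b≢a

    merge : Fin (suc n) → Fin n
    merge x with b ≟ x
    ... | yes _   = a′
    ... | no b≢x = punchOut b≢x

    contract : Multigraph (suc n) → Multigraph n
    contract H = mkGraph (map (λ e → merge (proj₁ e) , merge (proj₂ e)) (edges H))

    expand : Vec Bool n → Bool → Vec Bool (suc n)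
    expand T = insertAt T b

    lookup-expand-a : ∀ T v → lookup (expand T v) a ≡ lookup T a′
    lookup-expand-a T v = trans (cong (lookup (expand T v)) (sym (punchIn-punchOut b≢a))) (insertAt-punchIn T b v a′)

    lookup-expand : ∀ T x → lookup (expand T (lookup T a′)) x ≡ lookup T (merge x)
    lookup-expand T x with b ≟ x
    ... | yes refl = insertAt-lookup T b _
    ... | no b≢x  = trans (cong (lookup (expand T _)) (sym (punchIn-punchOut b≢x)))
                          (insertAt-punchIn T b _ (punchOut b≢x))

    cutSize-contract : ∀ H T → cutSize (contract H) T ≡ cutSize H (expand T (lookup T a′))
    cutSize-contract H T = begin
      cutSize (contract H) T
        ≡⟨ cutSize≡∑ (contract H) T ⟩
      ∑ (map _ (edges H)) (fromBool ∘ crosses T)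
        ≡⟨ ∑-map _ (edges H) _ ⟩
      ∑[ e ∈ edges H ] fromBool (lookup T (merge (proj₁ e)) xor lookup T (merge (proj₂ e)))
        ≡⟨ ∑-cong (edges H) (λ e → cong fromBool
             (sym (cong₂ _xor_ (lookup-expand T (proj₁ e)) (lookup-expand T (proj₂ e))))) ⟩
      ∑[ e ∈ edges H ] fromBool (crosses (expand T (lookup T a′)) e)
        ≡⟨ cutSize≡∑ H (expand T (lookup T a′)) ⟨
      cutSize H (expand T (lookup T a′)) ∎
      where open ≡-Reasoning

    contract-cutsAtLeast : ∀ {H l} → CutsAtLeast H l → CutsAtLeast (contract H) l
    contract-cutsAtLeast {H} cuts≥l T ((i , Ti≡true) , (j , Tj≡false)) =
      subst (_ ≤_) (sym (cutSize-contract H T)) (cuts≥l (expand T (lookup T a′))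
        ((punchIn b i , trans (insertAt-punchIn T b _ i) Ti≡true) ,
         (punchIn b j , trans (insertAt-punchIn T b _ j) Tj≡false)))

    crosses-expand : ∀ T v → crosses (expand T v) (a , b) ≡ lookup T a′ xor v
    crosses-expand T v = cong₂ _xor_ (lookup-expand-a T v) (insertAt-lookup T b v)

    smallCutCount-contract : ∀ H c → smallCutCount (contract H) c ≡
      ∑[ S ∈ allVecs (suc n) ] fromBool (not (crosses S (a , b)) ∧ isSmallCut H c S)
    smallCutCount-contract H c = trans (∑-cong (allVecs n) one-side-uncut) (sym (∑-allVecs-insertAt n b g))
      where
      g : Vec Bool (suc n) → ℕ
      g S = fromBool (not (crosses S (a , b)) ∧ isSmallCut H c S)
      -- Of the two extensions of T, exactly the one putting b on the side of a leaves ab uncut.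
      one-side-uncut : ∀ T → fromBool (isSmallCut (contract H) c T) ≡ g (expand T true) + g (expand T false)
      one-side-uncut T rewrite cutSize-contract H T | crosses-expand T true | crosses-expand T false with lookup T a′
      ... | true  = sym (+-identityʳ _)
      ... | false = refl

  -- Double counting of (small set, uncut link) pairs, through the contraction of each link.
  module _ {n} (H : Multigraph (suc n)) (c F : ℕ)
           (contract≤F : ∀ {a b : Fin (suc n)} (b≢a : b ≢ a) →
                         smallCutCount (Contraction.contract b≢a H) c ≤ F) where

    private
      small : Vec Bool (suc n) → Bool
      small = isSmallCut H c

      regroup : ∀ x y z → fromBool z * fromBool (x ∧ y) ≡ fromBool x * fromBool (y ∧ z)
      regroup true  true  true  = refl
      regroup true  true  false = refl
      regroup true  false z     = *-zeroʳ (fromBool z)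
      regroup false y     z     = *-zeroʳ (fromBool z)

      per-link : ∀ e → fromBool (isLink e) * (∑[ S ∈ allVecs (suc n) ] fromBool (not (crosses S e) ∧ small S))
                       ≤ fromBool (isLink e) * F
      per-link (u , v) with u ≟ v
      ... | yes _  = z≤n
      ... | no u≢v = *-monoʳ-≤ 1 (subst (_≤ F) (Contraction.smallCutCount-contract (u≢v ∘ sym) H c)
                                         (contract≤F (u≢v ∘ sym)))

    ∑-small-uncutLinks : ∑[ S ∈ allVecs (suc n) ] fromBool (isSmallCut H c S) * uncutLinks H S ≤ linkCount H * F
    ∑-small-uncutLinks = begin
      ∑[ S ∈ allVecs (suc n) ] fromBool (small S) * uncutLinks H S
        ≡⟨ ∑-cong (allVecs (suc n)) (λ S → *-distribˡ-∑ (fromBool (small S)) (edges H) _) ⟩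
      ∑[ S ∈ allVecs (suc n) ] ∑[ e ∈ edges H ] fromBool (small S) * fromBool (isLink e ∧ not (crosses S e))
        ≡⟨ ∑-comm (allVecs (suc n)) (edges H) _ ⟩
      ∑[ e ∈ edges H ] ∑[ S ∈ allVecs (suc n) ] fromBool (small S) * fromBool (isLink e ∧ not (crosses S e))
        ≡⟨ ∑-cong (edges H) (λ e → trans (∑-cong (allVecs (suc n)) (λ S → regroup (isLink e) _ (small S)))
                                          (sym (*-distribˡ-∑ (fromBool (isLink e)) (allVecs (suc n)) _))) ⟩
      ∑[ e ∈ edges H ] fromBool (isLink e) * (∑[ S ∈ allVecs (suc n) ] fromBool (not (crosses S e) ∧ small S))
        ≤⟨ ∑-mono (edges H) per-link ⟩
      ∑[ e ∈ edges H ] fromBool (isLink e) * F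
        ≡⟨ *-distribʳ-∑ F (edges H) _ ⟨
      linkCount H * F ∎
      where open ≤-Reasoning

  smallCutCount-linkCount : ∀ {n} (H : Multigraph n) c →
    smallCutCount H c * (2 * linkCount H)
      ≤ 2 * (∑[ S ∈ allVecs n ] fromBool (isSmallCut H c S) * uncutLinks H S) + smallCutCount H c * c
  smallCutCount-linkCount {n} H c = begin
    smallCutCount H c * (2 * linkCount H)
      ≡⟨ *-distribʳ-∑ (2 * linkCount H) (allVecs n) _ ⟩
    ∑[ S ∈ allVecs n ] fromBool (isSmallCut H c S) * (2 * linkCount H)
      ≤⟨ ∑-mono (allVecs n) per-set ⟩
    ∑[ S ∈ allVecs n ] (2 * (fromBool (isSmallCut H c S) * uncutLinks H S) + fromBool (isSmallCut H c S) * c)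
      ≡⟨ ∑-distrib-+ (allVecs n) _ _ ⟩
    (∑[ S ∈ allVecs n ] 2 * (fromBool (isSmallCut H c S) * uncutLinks H S))
      + (∑[ S ∈ allVecs n ] fromBool (isSmallCut H c S) * c)
      ≡⟨ cong₂ _+_ (*-distribˡ-∑ 2 (allVecs n) _) (*-distribʳ-∑ c (allVecs n) _) ⟨
    2 * (∑[ S ∈ allVecs n ] fromBool (isSmallCut H c S) * uncutLinks H S) + smallCutCount H c * c ∎
    where
    open ≤-Reasoning
    per-set : ∀ S → fromBool (isSmallCut H c S) * (2 * linkCount H)
                    ≤ 2 * (fromBool (isSmallCut H c S) * uncutLinks H S) + fromBool (isSmallCut H c S) * c
    per-set S with isSmallCut H c S in small
    ... | false = z≤n
    ... | true  = begin
      1 * (2 * linkCount H)                            ≡⟨ cong (λ m → 1 * (2 * m)) (uncutLinks+cutSize H S) ⟨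
      1 * (2 * (uncutLinks H S + cutSize H S))         ≡⟨ rearrange (uncutLinks H S) (cutSize H S) ⟩
      2 * (1 * uncutLinks H S) + 2 * cutSize H S       ≤⟨ +-monoʳ-≤ (2 * (1 * uncutLinks H S)) 2cut≤c ⟩
      2 * (1 * uncutLinks H S) + c                     ≡⟨ cong (2 * (1 * uncutLinks H S) +_) (*-identityˡ c) ⟨
      2 * (1 * uncutLinks H S) + 1 * c                 ∎
      where
      rearrange : ∀ u k → 1 * (2 * (u + k)) ≡ 2 * (1 * u) + 2 * k
      rearrange = solve-∀
      2cut≤c : 2 * cutSize H S ≤ c
      2cut≤c = ≤ᵇ⇒≤ (2 * cutSize H S) c (subst T (sym small) _)

  averaging-bound : ∀ {C M F s t l} .{{_ : NonZero M}} → (s + t) * l ≤ M → C * M ≤ M * F + C * (t * l) →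
                    C * s ≤ (s + t) * F
  averaging-bound {C} {M} {F} {s} {t} {l} sl+tl≤M CM≤MF+Ctl = *-cancelʳ-≤ (C * s) ((s + t) * F) M
    (+-cancelʳ-≤ (C * t * M) (C * s * M) ((s + t) * F * M) (begin
      C * s * M + C * t * M                  ≡⟨ lhs C M s t ⟩
      (s + t) * (C * M)                      ≤⟨ *-monoʳ-≤ (s + t) CM≤MF+Ctl ⟩
      (s + t) * (M * F + C * (t * l))        ≡⟨ rhs C M F s t l ⟩
      (s + t) * F * M + C * t * ((s + t) * l) ≤⟨ +-monoʳ-≤ ((s + t) * F * M) (*-monoʳ-≤ (C * t) sl+tl≤M) ⟩
      (s + t) * F * M + C * t * M            ∎))
    where
    open ≤-Reasoning
    lhs : ∀ C M s t → C * s * M + C * t * M ≡ (s + t) * (C * M)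
    lhs = solve-∀
    rhs : ∀ C M F s t l → (s + t) * (M * F + C * (t * l)) ≡ (s + t) * F * M + C * t * ((s + t) * l)
    rhs = solve-∀

  rising : ℕ → ℕ → ℕ
  rising a zero    = 1
  rising a (suc k) = a * rising (suc a) k

  rising-shift : ∀ a k → rising (suc a) k * a ≡ rising a k * (a + k)
  rising-shift a zero = cong (1 *_) (sym (+-identityʳ a))
  rising-shift a (suc k) = begin
    suc a * rising (suc (suc a)) k * a  ≡⟨ cong (_* a) (*-comm (suc a) (rising (suc (suc a)) k)) ⟩
    rising (suc (suc a)) k * suc a * a  ≡⟨ cong (_* a) (rising-shift (suc a) k) ⟩
    rising (suc a) k * (suc a + k) * a  ≡⟨ rearrange (rising (suc a) k) a k ⟩
    a * rising (suc a) k * (a + suc k)  ∎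
    where
    open ≡-Reasoning
    rearrange : ∀ r a k → r * (suc a + k) * a ≡ a * r * (a + suc k)
    rearrange = solve-∀

  rising-positive : ∀ a k → 1 ≤ rising (suc a) k
  rising-positive a zero    = s≤s z≤n
  rising-positive a (suc k) = *-mono-≤ {1} {suc a} (s≤s z≤n) (rising-positive (suc a) k)

  rising≤^ : ∀ a k → rising (suc a) k ≤ (a + k) ^ k
  rising≤^ a zero    = s≤s z≤n
  rising≤^ a (suc k) = subst (λ m → rising (suc a) (suc k) ≤ m ^ suc k) (sym (+-suc a k))
    (*-mono-≤ (m≤m+n (suc a) k) (rising≤^ (suc a) k))

  length-allVecs : ∀ n → length (allVecs n) ≡ 2 ^ n
  length-allVecs zero = refl
  length-allVecs (suc n) = begin
    length (map (true ∷_) (allVecs n) ++ map (false ∷_) (allVecs n))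
      ≡⟨ length-++ (map (true ∷_) (allVecs n)) ⟩
    length (map (true ∷_) (allVecs n)) + length (map (false ∷_) (allVecs n))
      ≡⟨ cong₂ _+_ (length-map (true ∷_) (allVecs n)) (length-map (false ∷_) (allVecs n)) ⟩
    length (allVecs n) + length (allVecs n)
      ≡⟨ cong (λ m → m + m) (length-allVecs n) ⟩
    2 ^ n + 2 ^ n
      ≡⟨ cong (2 ^ n +_) (+-identityʳ (2 ^ n)) ⟨
    2 ^ suc n ∎
    where open ≡-Reasoning

  smallCutCount≤2^ : ∀ {n} (H : Multigraph n) c → smallCutCount H c ≤ 2 ^ n
  smallCutCount≤2^ {n} H c = begin
    smallCutCount H c          ≤⟨ ∑-mono (allVecs n) (λ S → fromBool≤1 (isSmallCut H c S)) ⟩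
    ∑[ S ∈ allVecs n ] 1       ≡⟨ ∑-const (allVecs n) 1 ⟩
    length (allVecs n) * 1     ≡⟨ *-identityʳ _ ⟩
    length (allVecs n)         ≡⟨ length-allVecs n ⟩
    2 ^ n                      ∎
    where
    open ≤-Reasoning
    fromBool≤1 : ∀ b → fromBool b ≤ 1
    fromBool≤1 true  = s≤s z≤n
    fromBool≤1 false = z≤n

  smallCutCount-rising : ∀ t d {n l} (H : Multigraph n) → n ≡ suc (d + t) → 1 ≤ l → CutsAtLeast H l →
                         smallCutCount H (t * l) ≤ 2 ^ suc t * rising (2 + d) t
  smallCutCount-rising t zero H refl _ _ =
    ≤-trans (smallCutCount≤2^ H _)
            (≤-trans (≤-reflexive (sym (*-identityʳ _))) (*-monoʳ-≤ (2 ^ suc t) (rising-positive 1 t)))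
  smallCutCount-rising t (suc d) {l = l} H refl l≥1 cuts≥l =
    *-cancelʳ-≤ C (2 ^ suc t * rising (3 + d) t) (2 + d) (begin
      C * (2 + d)
        ≤⟨ averaging-bound {C} {M} {F} {2 + d} {t} {l} {{M≢0}} (degree-bound H cuts≥l) C·M≤M·F+C·t·l ⟩
      (2 + d + t) * (2 ^ suc t * rising (2 + d) t) ≡⟨ rearrange (2 + d + t) (2 ^ suc t) (rising (2 + d) t) ⟩
      2 ^ suc t * (rising (2 + d) t * (2 + d + t)) ≡⟨ cong (2 ^ suc t *_) (rising-shift (2 + d) t) ⟨
      2 ^ suc t * (rising (3 + d) t * (2 + d))     ≡⟨ *-assoc (2 ^ suc t) _ _ ⟨
      2 ^ suc t * rising (3 + d) t * (2 + d)       ∎)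
    where
    open ≤-Reasoning
    C M F : ℕ
    C = smallCutCount H (t * l)
    M = 2 * linkCount H
    F = 2 ^ suc t * rising (2 + d) t
    M≢0 : NonZero M
    M≢0 = >-nonZero (≤-trans (*-mono-≤ {1} {2 + d + t} (s≤s z≤n) l≥1) (degree-bound H cuts≥l))
    contract≤F : ∀ {a b} (b≢a : b ≢ a) → smallCutCount (Contraction.contract b≢a H) (t * l) ≤ F
    contract≤F b≢a = smallCutCount-rising t d (Contraction.contract b≢a H) refl l≥1
                                          (Contraction.contract-cutsAtLeast b≢a {H} cuts≥l)
    C·M≤M·F+C·t·l : C * M ≤ M * F + C * (t * l)
    C·M≤M·F+C·t·l = begin
      C * M
        ≤⟨ smallCutCount-linkCount H (t * l) ⟩
      2 * (∑[ S ∈ allVecs _ ] fromBool (isSmallCut H (t * l) S) * uncutLinks H S) + C * (t * l)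
        ≤⟨ +-monoˡ-≤ (C * (t * l)) (*-monoʳ-≤ 2 (∑-small-uncutLinks H (t * l) F contract≤F)) ⟩
      2 * (linkCount H * F) + C * (t * l)
        ≡⟨ cong (_+ C * (t * l)) (*-assoc 2 (linkCount H) F) ⟨
      M * F + C * (t * l) ∎
    rearrange : ∀ m x y → m * (x * y) ≡ x * (y * m)
    rearrange = solve-∀

  smallCutCount-bound : ∀ t {n l} (H : Multigraph n) → 1 ≤ n → 1 ≤ l → CutsAtLeast H l →
                        smallCutCount H (t * l) ≤ 2 ^ suc t * n ^ t
  smallCutCount-bound t {n} {l} H n≥1 l≥1 cuts≥l with suc t ≤? n
  ... | yes t<n = ≤-trans (smallCutCount-rising t d H n≡ l≥1 cuts≥l)
                          (*-monoʳ-≤ (2 ^ suc t) (subst (λ m → rising (2 + d) t ≤ m ^ t) (sym n≡) (rising≤^ (suc d) t)))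
    where
    d : ℕ
    d = n ∸ suc t
    n≡ : n ≡ suc (d + t)
    n≡ = trans (sym (m+[n∸m]≡n t<n)) (cong suc (+-comm t d))
  ... | no  n≤t = begin
    smallCutCount H (t * l) ≤⟨ smallCutCount≤2^ H (t * l) ⟩
    2 ^ n                   ≤⟨ ^-monoʳ-≤ 2 (≤-trans (n≤1+n n) (≰⇒> n≤t)) ⟩
    2 ^ suc t               ≡⟨ *-identityʳ _ ⟨
    2 ^ suc t * 1           ≤⟨ *-monoʳ-≤ (2 ^ suc t) (subst (_≤ n ^ t) (^-zeroˡ t) (^-monoˡ-≤ t n≥1)) ⟩
    2 ^ suc t * n ^ t       ∎
    where open ≤-Reasoning

  module _ (l : ℕ) .{{_ : NonZero l}} where

    level : ℕ → ℕ
    level k = (2 * (k ∸ l)) / l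

    level≤2k : ∀ k → level k ≤ 2 * k
    level≤2k k = ≤-trans (m/n≤m (2 * (k ∸ l)) l) (*-monoʳ-≤ 2 (m∸n≤m k l))

    level≤⇒small : ∀ {k t} → level k ≤ t → 2 * k ≤ (t + 3) * l
    level≤⇒small {k} {t} v≤t = <⇒≤ (begin-strict
      2 * k                      ≤⟨ *-monoʳ-≤ 2 (≤-trans (m≤n+m∸n k l) (≤-reflexive (+-comm l _))) ⟩
      2 * (k ∸ l + l)            ≡⟨ *-distribˡ-+ 2 (k ∸ l) l ⟩
      2 * (k ∸ l) + 2 * l        <⟨ +-monoˡ-< (2 * l) 2j<[1+v]l ⟩
      suc (level k) * l + 2 * l  ≤⟨ +-monoˡ-≤ (2 * l) (*-monoˡ-≤ l (s≤s v≤t)) ⟩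
      suc t * l + 2 * l          ≡⟨ rearrange t l ⟩
      (t + 3) * l                ∎)
      where
      open ≤-Reasoning
      m : ℕ
      m = 2 * (k ∸ l)
      2j<[1+v]l : m < suc (level k) * l
      2j<[1+v]l = begin-strict
        m                  ≡⟨ m≡m%n+[m/n]*n m l ⟩
        m % l + m / l * l  <⟨ +-monoˡ-< (m / l * l) (m%n<n m l) ⟩
        l + m / l * l      ∎
      rearrange : ∀ t l → suc t * l + 2 * l ≡ (t + 3) * l
      rearrange = solve-∀

    far-cut-exponent : ∀ {k} → 11 * l ≤ 10 * k → l * suc (level k) ≤ (k ∸ l) * 12
    far-cut-exponent {k} 11l≤10k = begin
      l * suc (level k)  ≡⟨ *-suc l (level k) ⟩
      l + l * level k    ≡⟨ cong (l +_) (*-comm l (level k)) ⟩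
      l + level k * l    ≤⟨ +-mono-≤ l≤10j (m/n*n≤m (2 * j) l) ⟩
      10 * j + 2 * j     ≡⟨ rearrange j ⟩
      j * 12             ∎
      where
      open ≤-Reasoning
      j : ℕ
      j = k ∸ l
      l≤k : l ≤ k
      l≤k = *-cancelˡ-≤ 10 (≤-trans (*-monoˡ-≤ l (n≤1+n 10)) 11l≤10k)
      l≤10j : l ≤ 10 * j
      l≤10j = +-cancelˡ-≤ (10 * l) l (10 * j) (begin
        10 * l + l       ≡⟨ +-comm (10 * l) l ⟩
        11 * l           ≤⟨ 11l≤10k ⟩
        10 * k           ≡⟨ cong (10 *_) (m+[n∸m]≡n l≤k) ⟨
        10 * (l + j)     ≡⟨ *-distribˡ-+ 10 l j ⟩
        10 * l + 10 * j  ∎)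
      rearrange : ∀ j → 10 * j + 2 * j ≡ j * 12
      rearrange = solve-∀

  ∑-filterᵇ-≤ : ∀ {A : Set} (P : A → Bool) xs f → ∑ (filterᵇ P xs) f ≤ ∑ xs f
  ∑-filterᵇ-≤ P xs f = subst (∑ (filterᵇ P xs) f ≤_) (sym (∑-partition P xs f)) (m≤m+n _ _)

  ∑-cutSides-≤ : ∀ n f → ∑ (cutSides n) f ≤ ∑ (allVecs n) f
  ∑-cutSides-≤ zero    f = z≤n
  ∑-cutSides-≤ (suc n) f = begin
    ∑ (map (true ∷_) notAllTrue) f                                  ≡⟨ ∑-map (true ∷_) notAllTrue f ⟩
    ∑ notAllTrue (f ∘ (true ∷_))                                    ≤⟨ ∑-filterᵇ-≤ _ (allVecs n) _ ⟩
    ∑ (allVecs n) (f ∘ (true ∷_))                                   ≤⟨ m≤m+n _ _ ⟩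
    ∑ (allVecs n) (f ∘ (true ∷_)) + ∑ (allVecs n) (f ∘ (false ∷_))  ≡⟨ ∑-allVecs-suc n f ⟨
    ∑ (allVecs (suc n)) f                                           ∎
    where
    open ≤-Reasoning
    notAllTrue : List (Vec Bool n)
    notAllTrue = filterᵇ (λ v → not (allTrue v)) (allVecs n)

  levelCount-bound : ∀ {n l} (G : Multigraph n) .{{_ : NonZero l}} → 2 ≤ n → CutsAtLeast G l →
                     ∀ (P : Vec Bool n → Bool) t →
                     ∑[ S ∈ filterᵇ P (cutSides n) ] fromBool (level l (cutSize G S) ≤ᵇ t) ≤ n ^ (2 * t + 7)
  levelCount-bound {n} {l} G 2≤n cuts≥l P t = begin
    ∑[ S ∈ filterᵇ P (cutSides n) ] fromBool (level l (cutSize G S) ≤ᵇ t)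
      ≤⟨ ∑-filterᵇ-≤ P (cutSides n) _ ⟩
    ∑[ S ∈ cutSides n ] fromBool (level l (cutSize G S) ≤ᵇ t)
      ≤⟨ ∑-cutSides-≤ n _ ⟩
    ∑[ S ∈ allVecs n ] fromBool (level l (cutSize G S) ≤ᵇ t)
      ≤⟨ ∑-mono (allVecs n) (λ S → fromBool-mono (≤⇒≤ᵇ ∘ level≤⇒small l ∘ ≤ᵇ⇒≤ _ t)) ⟩
    smallCutCount G ((t + 3) * l)
      ≤⟨ smallCutCount-bound (t + 3) G (≤-trans (s≤s z≤n) 2≤n) (>-nonZero⁻¹ l) cuts≥l ⟩
    2 ^ suc (t + 3) * n ^ (t + 3)
      ≤⟨ *-monoˡ-≤ (n ^ (t + 3)) (^-monoˡ-≤ (suc (t + 3)) 2≤n) ⟩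
    n ^ suc (t + 3) * n ^ (t + 3)
      ≡⟨ ^-distribˡ-+-* n (suc (t + 3)) (t + 3) ⟨
    n ^ (suc (t + 3) + (t + 3))
      ≡⟨ cong (n ^_) (exponent t) ⟩
    n ^ (2 * t + 7) ∎
    where
    open ≤-Reasoning
    exponent : ∀ t → suc (t + 3) + (t + 3) ≡ 2 * t + 7
    exponent = solve-∀

  not-<ᵇ⇒≥ : ∀ {m n} → T (not (m <ᵇ n)) → n ≤ m
  not-<ᵇ⇒≥ {m} {n} m≮ᵇn = ≮⇒≥ (λ m<n → subst (T ∘ not) (Equivalence.to T-≡ (<⇒<ᵇ m<n)) m≮ᵇn)


module CutWeights where
  open import Data.Bool using (Bool; not)
  open import Data.Empty using (⊥-elim)
  open import Data.Integer as ℤ using (+≤+)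
  import Data.Integer.Properties as ℤ
  open import Data.List using (List; []; _∷_; map; length; filterᵇ; upTo)
  open import Data.List.Properties using (map-upTo; length-filter)
  open import Data.List.Membership.Propositional using (_∈_)
  open import Data.List.Membership.Propositional.Properties using (∈-upTo⁺)
  open import Data.List.Relation.Unary.Any using (here; there)
  open import Data.Nat as ℕ using (ℕ; zero; suc; NonZero; _≤ᵇ_)
  import Data.Nat.Coprimality as Coprime
  import Data.Nat.Properties as ℕ
  open import Data.Nat.Tactic.RingSolver using (solve-∀)
  open import Data.Rational using (ℚ; mkℚ; 0ℚ; 1ℚ; _+_; _-_; -_; _*_; _/_; _≤_; _<_; *≤*; nonNegative; positive)
  open import Data.Rational.Properties
  open import Algebra.Properties.CommutativeSemigroup
    (CommutativeRing.*-commutativeSemigroup +-*-commutativeRing) using (interchange)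
  open import Data.Rational.Solver using (module +-*-Solver)
  open import Data.Vec using (Vec)
  open import Function using (_∘_)
  open import Relation.Binary.PropositionalEquality
  open import Relation.Nullary using (yes; no)

  open CutCounting using (fromBool; fromBool-T; CutsAtLeast; isNearMinCut; level; level≤2k; far-cut-exponent;
                          levelCount-bound; not-<ᵇ⇒≥)
  module ℕ∑ = ListSum ℕ.+-*-commutativeSemiring
  open ListSum (CommutativeRing.commutativeSemiring +-*-commutativeRing) public
  open Ordered {_≤_ = _≤_} ≤-refl +-mono-≤ public

  0≤1 : 0ℚ ≤ 1ℚ
  0≤1 = nonNegative⁻¹ 1ℚ

  *-monoʳ-≤-0≤ : ∀ {r p q} → 0ℚ ≤ r → p ≤ q → p * r ≤ q * r
  *-monoʳ-≤-0≤ {r} 0≤r = *-monoʳ-≤-nonNeg r {{nonNegative 0≤r}}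

  *-monoˡ-≤-0≤ : ∀ {r p q} → 0ℚ ≤ r → p ≤ q → r * p ≤ r * q
  *-monoˡ-≤-0≤ {r} 0≤r = *-monoˡ-≤-nonNeg r {{nonNegative 0≤r}}

  *-mono-≤-0≤ : ∀ {p q r s} → 0ℚ ≤ p → 0ℚ ≤ r → p ≤ q → r ≤ s → p * r ≤ q * s
  *-mono-≤-0≤ 0≤p 0≤r p≤q r≤s =
    ≤-trans (*-monoʳ-≤-0≤ 0≤r p≤q) (*-monoˡ-≤-0≤ (≤-trans 0≤p p≤q) r≤s)

  *-nonneg : ∀ {p q} → 0ℚ ≤ p → 0ℚ ≤ q → 0ℚ ≤ p * q
  *-nonneg {p} {q} 0≤p 0≤q = subst (_≤ p * q) (*-zeroˡ q) (*-monoʳ-≤-0≤ 0≤q 0≤p)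

  ^ℚ-+ : ∀ x a b → x ^ℚ (a ℕ.+ b) ≡ x ^ℚ a * x ^ℚ b
  ^ℚ-+ x zero    b = sym (*-identityˡ _)
  ^ℚ-+ x (suc a) b = trans (cong (x *_) (^ℚ-+ x a b)) (sym (*-assoc x _ _))

  ^ℚ-* : ∀ x a b → x ^ℚ (a ℕ.* b) ≡ (x ^ℚ a) ^ℚ b
  ^ℚ-* x a zero    rewrite ℕ.*-zeroʳ a = refl
  ^ℚ-* x a (suc b) rewrite ℕ.*-suc a b = trans (^ℚ-+ x a (a ℕ.* b)) (cong (x ^ℚ a *_) (^ℚ-* x a b))

  ^ℚ-nonneg : ∀ {x} a → 0ℚ ≤ x → 0ℚ ≤ x ^ℚ a
  ^ℚ-nonneg zero    0≤x = 0≤1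
  ^ℚ-nonneg (suc a) 0≤x = *-nonneg 0≤x (^ℚ-nonneg a 0≤x)

  ^ℚ-≤1 : ∀ {x} a → 0ℚ ≤ x → x ≤ 1ℚ → x ^ℚ a ≤ 1ℚ
  ^ℚ-≤1 zero    0≤x x≤1 = ≤-refl
  ^ℚ-≤1 {x} (suc a) 0≤x x≤1 =
    subst (x * x ^ℚ a ≤_) (*-identityˡ 1ℚ) (*-mono-≤-0≤ 0≤x (^ℚ-nonneg a 0≤x) x≤1 (^ℚ-≤1 a 0≤x x≤1))

  ^ℚ-antitone : ∀ {x a b} → 0ℚ ≤ x → x ≤ 1ℚ → a ℕ.≤ b → x ^ℚ b ≤ x ^ℚ a
  ^ℚ-antitone {x} {a} {b} 0≤x x≤1 a≤b = begin
    x ^ℚ b                        ≡⟨ cong (x ^ℚ_) (ℕ.m+[n∸m]≡n a≤b) ⟨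
    x ^ℚ (a ℕ.+ (b ℕ.∸ a))        ≡⟨ ^ℚ-+ x a (b ℕ.∸ a) ⟩
    x ^ℚ a * x ^ℚ (b ℕ.∸ a)       ≤⟨ *-monoˡ-≤-0≤ (^ℚ-nonneg a 0≤x) (^ℚ-≤1 (b ℕ.∸ a) 0≤x x≤1) ⟩
    x ^ℚ a * 1ℚ                   ≡⟨ *-identityʳ _ ⟩
    x ^ℚ a                        ∎
    where open ≤-Reasoning

  ^ℚ-mono-≤ : ∀ {x y} a → 0ℚ ≤ x → x ≤ y → x ^ℚ a ≤ y ^ℚ a
  ^ℚ-mono-≤ zero    0≤x x≤y = ≤-refl
  ^ℚ-mono-≤ (suc a) 0≤x x≤y = *-mono-≤-0≤ 0≤x (^ℚ-nonneg a 0≤x) x≤y (^ℚ-mono-≤ a 0≤x x≤y)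

  ^ℚ-mono-< : ∀ {x y} a → 0ℚ ≤ x → x < y → x ^ℚ suc a < y ^ℚ suc a
  ^ℚ-mono-< {x} {y} zero 0≤x x<y = subst₂ _<_ (sym (*-identityʳ x)) (sym (*-identityʳ y)) x<y
  ^ℚ-mono-< {x} {y} (suc a) 0≤x x<y = begin-strict
    x * x ^ℚ suc a   ≤⟨ *-monoʳ-≤-0≤ (^ℚ-nonneg (suc a) 0≤x) (<⇒≤ x<y) ⟩
    y * x ^ℚ suc a   <⟨ *-monoʳ-<-pos y {{positive (≤-<-trans 0≤x x<y)}} (^ℚ-mono-< a 0≤x x<y) ⟩
    y * y ^ℚ suc a   ∎
    where open ≤-Reasoning

  ^ℚ-cancel-≤ : ∀ {x y} a → 0ℚ ≤ y → x ^ℚ suc a ≤ y ^ℚ suc a → x ≤ y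
  ^ℚ-cancel-≤ {x} {y} a 0≤y xᵃ≤yᵃ with x ≤? y
  ... | yes x≤y = x≤y
  ... | no  x≰y = ⊥-elim (<-irrefl refl (≤-<-trans xᵃ≤yᵃ (^ℚ-mono-< a 0≤y (≰⇒> x≰y))))

  ^ℚ-inverse : ∀ {x y} a → x * y ≡ 1ℚ → x ^ℚ a * y ^ℚ a ≡ 1ℚ
  ^ℚ-inverse zero    _    = *-identityˡ 1ℚ
  ^ℚ-inverse {x} {y} (suc a) xy≡1 = begin
    (x * x ^ℚ a) * (y * y ^ℚ a)  ≡⟨ interchange x (x ^ℚ a) y (y ^ℚ a) ⟩
    (x * y) * (x ^ℚ a * y ^ℚ a)  ≡⟨ cong₂ _*_ xy≡1 (^ℚ-inverse a xy≡1) ⟩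
    1ℚ * 1ℚ                      ≡⟨ *-identityˡ 1ℚ ⟩
    1ℚ                           ∎
    where open ≡-Reasoning

  fromℕ : ℕ → ℚ
  fromℕ k = ℤ.+ k / 1

  fromℕ≡mkℚ : ∀ k → fromℕ k ≡ mkℚ (ℤ.+ k) 0 (Coprime.sym (Coprime.1-coprimeTo k))
  fromℕ≡mkℚ k = normalize-coprime (Coprime.sym (Coprime.1-coprimeTo k))

  fromℕ-+ : ∀ a b → fromℕ (a ℕ.+ b) ≡ fromℕ a + fromℕ b
  fromℕ-+ a b rewrite fromℕ≡mkℚ a | fromℕ≡mkℚ b =
    cong (_/ 1) (trans (ℤ.pos-+ a b) (sym (cong₂ ℤ._+_ (ℤ.*-identityʳ (ℤ.+ a)) (ℤ.*-identityʳ (ℤ.+ b)))))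

  fromℕ-* : ∀ a b → fromℕ (a ℕ.* b) ≡ fromℕ a * fromℕ b
  fromℕ-* a b rewrite fromℕ≡mkℚ a | fromℕ≡mkℚ b = cong (_/ 1) (ℤ.pos-* a b)

  fromℕ-mono-≤ : ∀ {a b} → a ℕ.≤ b → fromℕ a ≤ fromℕ b
  fromℕ-mono-≤ {a} {b} a≤b rewrite fromℕ≡mkℚ a | fromℕ≡mkℚ b =
    *≤* (subst₂ ℤ._≤_ (sym (ℤ.*-identityʳ (ℤ.+ a))) (sym (ℤ.*-identityʳ (ℤ.+ b))) (+≤+ a≤b))

  fromℕ-^ : ∀ n k → fromℕ n ^ℚ k ≡ fromℕ (n ℕ.^ k)
  fromℕ-^ n zero    = refl
  fromℕ-^ n (suc k) = trans (cong (fromℕ n *_) (fromℕ-^ n k)) (sym (fromℕ-* n (n ℕ.^ k)))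

  fromℕ*1/ : ∀ n .{{_ : NonZero n}} → fromℕ n * (ℤ.+ 1 / n) ≡ 1ℚ
  fromℕ*1/ n@(suc n-1) rewrite normalize-coprime {1} {n-1} (Coprime.1-coprimeTo n) | fromℕ≡mkℚ n =
    *-inverseʳ (mkℚ (ℤ.+ n) 0 (Coprime.sym (Coprime.1-coprimeTo n)))

  ∑-nonneg : ∀ {A : Set} (xs : List A) {f} → (∀ x → 0ℚ ≤ f x) → 0ℚ ≤ ∑ xs f
  ∑-nonneg xs {f} 0≤f = subst (_≤ ∑ xs f) (∑-zero xs) (∑-mono xs 0≤f)

  ∑-∈ : ∀ {A : Set} {x} (xs : List A) {f} → (∀ y → 0ℚ ≤ f y) → x ∈ xs → f x ≤ ∑ xs f
  ∑-∈ {x = x} (y ∷ xs) {f} 0≤f (here refl) =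
    subst (_≤ f x + ∑ xs f) (+-identityʳ (f x)) (+-monoʳ-≤ (f x) (∑-nonneg xs 0≤f))
  ∑-∈ (y ∷ xs) {f} 0≤f (there x∈xs) =
    subst (_≤ f y + ∑ xs f) (+-identityˡ _) (+-mono-≤ (0≤f y) (∑-∈ xs 0≤f x∈xs))

  fromℕ-∑ : ∀ {A : Set} (xs : List A) f → fromℕ (ℕ∑.∑ xs f) ≡ ∑[ x ∈ xs ] fromℕ (f x)
  fromℕ-∑ [] f = refl
  fromℕ-∑ (x ∷ xs) f = trans (fromℕ-+ (f x) _) (cong (fromℕ (f x) +_) (fromℕ-∑ xs f))

  ∑-upTo-suc : ∀ T (g : ℕ → ℚ) → ∑ (upTo (suc T)) g ≡ g 0 + ∑ (upTo T) (g ∘ suc)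
  ∑-upTo-suc T g = cong (g 0 +_) (trans (cong (λ ts → ∑ ts g) (sym (map-upTo suc T))) (∑-map suc (upTo T) g))

  geometric-sum≤2 : ∀ {r} T → 0ℚ ≤ r → r + r ≤ 1ℚ → ∑[ t ∈ upTo T ] r ^ℚ t ≤ 1ℚ + 1ℚ
  geometric-sum≤2 zero    0≤r r+r≤1 = +-mono-≤ 0≤1 0≤1
  geometric-sum≤2 {r} (suc T) 0≤r r+r≤1 = begin
    ∑[ t ∈ upTo (suc T) ] r ^ℚ t
      ≡⟨ ∑-upTo-suc T (r ^ℚ_) ⟩
    1ℚ + (∑[ t ∈ upTo T ] r * r ^ℚ t)
      ≡⟨ cong (1ℚ +_) (*-distribˡ-∑ r (upTo T) (r ^ℚ_)) ⟨
    1ℚ + r * (∑[ t ∈ upTo T ] r ^ℚ t)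
      ≤⟨ +-monoʳ-≤ 1ℚ (*-monoˡ-≤-0≤ 0≤r (geometric-sum≤2 T 0≤r r+r≤1)) ⟩
    1ℚ + r * (1ℚ + 1ℚ)
      ≡⟨ cong (1ℚ +_) (trans (*-distribˡ-+ r 1ℚ 1ℚ) (cong₂ _+_ r*1≡r r*1≡r)) ⟩
    1ℚ + (r + r)
      ≤⟨ +-monoʳ-≤ 1ℚ r+r≤1 ⟩
    1ℚ + 1ℚ ∎
    where
    open ≤-Reasoning
    r*1≡r : r * 1ℚ ≡ r
    r*1≡r = *-identityʳ r

  -- Each x is charged to the layer t = level x, whose count includes x.
  layer-cake : ∀ {A : Set} (xs : List A) (level : A → ℕ) (g : ℕ → ℚ) T →
               (∀ t → 0ℚ ≤ g t) → (∀ x → level x ℕ.< T) →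
               ∑[ x ∈ xs ] g (level x)
                 ≤ ∑[ t ∈ upTo T ] g t * fromℕ (ℕ∑.∑[ x ∈ xs ] fromBool (level x ≤ᵇ t))
  layer-cake xs level g T 0≤g level<T = begin
    ∑[ x ∈ xs ] g (level x)
      ≤⟨ ∑-mono xs charge ⟩
    ∑[ x ∈ xs ] ∑[ t ∈ upTo T ] g t * fromℕ (fromBool (level x ≤ᵇ t))
      ≡⟨ ∑-comm xs (upTo T) _ ⟩
    ∑[ t ∈ upTo T ] ∑[ x ∈ xs ] g t * fromℕ (fromBool (level x ≤ᵇ t))
      ≡⟨ ∑-cong (upTo T) (λ t → trans (sym (*-distribˡ-∑ (g t) xs _)) (cong (g t *_) (sym (fromℕ-∑ xs _)))) ⟩
    ∑[ t ∈ upTo T ] g t * fromℕ (ℕ∑.∑[ x ∈ xs ] fromBool (level x ≤ᵇ t)) ∎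
    where
    open ≤-Reasoning
    0≤term : ∀ v t → 0ℚ ≤ g t * fromℕ (fromBool (v ≤ᵇ t))
    0≤term v t = *-nonneg (0≤g t) (fromℕ-mono-≤ {0} {fromBool (v ≤ᵇ t)} ℕ.z≤n)
    charge : ∀ x → g (level x) ≤ ∑[ t ∈ upTo T ] g t * fromℕ (fromBool (level x ≤ᵇ t))
    charge x = begin
      g (level x)
        ≡⟨ *-identityʳ _ ⟨
      g (level x) * 1ℚ
        ≡⟨ cong (λ b → g (level x) * fromℕ b) (fromBool-T (ℕ.≤⇒≤ᵇ (ℕ.≤-refl {level x}))) ⟨
      g (level x) * fromℕ (fromBool (level x ≤ᵇ level x))
        ≤⟨ ∑-∈ (upTo T) (0≤term (level x)) (∈-upTo⁺ (level<T x)) ⟩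
      ∑[ t ∈ upTo T ] g t * fromℕ (fromBool (level x ≤ᵇ t)) ∎

  sumℚ-map : ∀ {A : Set} (xs : List A) f → sumℚ (map f xs) ≡ ∑ xs f
  sumℚ-map []       f = refl
  sumℚ-map (x ∷ xs) f = cong (f x +_) (sumℚ-map xs f)

  far-cut-weight : ∀ {p w : ℚ} {l k} .{{_ : NonZero l}} → 0ℚ ≤ p → p ≤ 1ℚ → 0ℚ ≤ w → w ≤ 1ℚ →
              p ^ℚ l ≤ w ^ℚ 1000 → 11 ℕ.* l ℕ.≤ 10 ℕ.* k →
              p ^ℚ k ≤ p ^ℚ l * w ^ℚ (9 ℕ.+ 3 ℕ.* level l k)
  far-cut-weight {p} {w} {l} {k} 0≤p p≤1 0≤w w≤1 pˡ≤w¹⁰⁰⁰ 11l≤10k = begin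
    p ^ℚ k           ≡⟨ cong (p ^ℚ_) (ℕ.m+[n∸m]≡n l≤k) ⟨
    p ^ℚ (l ℕ.+ j)   ≡⟨ ^ℚ-+ p l j ⟩
    p ^ℚ l * p ^ℚ j  ≤⟨ *-monoˡ-≤-0≤ (^ℚ-nonneg l 0≤p) (^ℚ-cancel-≤ 11 (^ℚ-nonneg e 0≤w) pʲ¹²≤wᵉ¹²) ⟩
    p ^ℚ l * w ^ℚ e  ∎
    where
    open ≤-Reasoning
    j v e : ℕ
    j = k ℕ.∸ l
    v = level l k
    e = 9 ℕ.+ 3 ℕ.* v
    l≤k : l ℕ.≤ k
    l≤k = ℕ.*-cancelˡ-≤ 10 (ℕ.≤-trans (ℕ.*-monoˡ-≤ l (ℕ.n≤1+n 10)) 11l≤10k)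
    e*12≤1000*[1+v] : e ℕ.* 12 ℕ.≤ 1000 ℕ.* suc v
    e*12≤1000*[1+v] = subst₂ ℕ._≤_ (sym (lhs v)) (sym (rhs v))
      (ℕ.+-mono-≤ (ℕ.m≤m+n 108 892) (ℕ.*-monoˡ-≤ v (ℕ.m≤m+n 36 964)))
      where
      lhs : ∀ v → (9 ℕ.+ 3 ℕ.* v) ℕ.* 12 ≡ 108 ℕ.+ 36 ℕ.* v
      lhs = solve-∀
      rhs : ∀ v → 1000 ℕ.* suc v ≡ 1000 ℕ.+ (36 ℕ.+ 964) ℕ.* v
      rhs = solve-∀
    pʲ¹²≤wᵉ¹² : (p ^ℚ j) ^ℚ 12 ≤ (w ^ℚ e) ^ℚ 12
    pʲ¹²≤wᵉ¹² = begin
      (p ^ℚ j) ^ℚ 12          ≡⟨ ^ℚ-* p j 12 ⟨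
      p ^ℚ (j ℕ.* 12)         ≤⟨ ^ℚ-antitone 0≤p p≤1 (far-cut-exponent l 11l≤10k) ⟩
      p ^ℚ (l ℕ.* suc v)      ≡⟨ ^ℚ-* p l (suc v) ⟩
      (p ^ℚ l) ^ℚ suc v       ≤⟨ ^ℚ-mono-≤ (suc v) (^ℚ-nonneg l 0≤p) pˡ≤w¹⁰⁰⁰ ⟩
      (w ^ℚ 1000) ^ℚ suc v    ≡⟨ ^ℚ-* w 1000 (suc v) ⟨
      w ^ℚ (1000 ℕ.* suc v)   ≤⟨ ^ℚ-antitone 0≤w w≤1 e*12≤1000*[1+v] ⟩
      w ^ℚ (e ℕ.* 12)         ≡⟨ ^ℚ-* w e 12 ⟩
      (w ^ℚ e) ^ℚ 12          ∎

  n*w≡1⇒w+w≤1 : ∀ {n w} → 2 ℕ.≤ n → 0ℚ ≤ w → fromℕ n * w ≡ 1ℚ → w + w ≤ 1ℚ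
  n*w≡1⇒w+w≤1 {n} {w} 2≤n 0≤w nw≡1 = begin
    w + w             ≡⟨ cong₂ _+_ (*-identityˡ w) (*-identityˡ w) ⟨
    1ℚ * w + 1ℚ * w   ≡⟨ *-distribʳ-+ w 1ℚ 1ℚ ⟨
    fromℕ 2 * w       ≤⟨ *-monoʳ-≤-0≤ 0≤w (fromℕ-mono-≤ 2≤n) ⟩
    fromℕ n * w       ≡⟨ nw≡1 ⟩
    1ℚ                ∎
    where open ≤-Reasoning

  ∑w²wᵗ≤w : ∀ {w} L → 0ℚ ≤ w → w + w ≤ 1ℚ → ∑[ t ∈ upTo L ] w ^ℚ 2 * w ^ℚ t ≤ w
  ∑w²wᵗ≤w {w} L 0≤w w+w≤1 = begin
    ∑[ t ∈ upTo L ] w ^ℚ 2 * w ^ℚ t      ≡⟨ *-distribˡ-∑ (w ^ℚ 2) (upTo L) (w ^ℚ_) ⟨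
    w ^ℚ 2 * (∑[ t ∈ upTo L ] w ^ℚ t)    ≤⟨ *-monoˡ-≤-0≤ (^ℚ-nonneg 2 0≤w) (geometric-sum≤2 L 0≤w w+w≤1) ⟩
    w ^ℚ 2 * (1ℚ + 1ℚ)                   ≡⟨ rearrange w ⟩
    w * (w + w)                          ≤⟨ *-monoˡ-≤-0≤ 0≤w w+w≤1 ⟩
    w * 1ℚ                               ≡⟨ *-identityʳ w ⟩
    w                                    ∎
    where
    open ≤-Reasoning
    open +-*-Solver using (solve; _:=_; _:+_; _:*_; con)
    rearrange : ∀ w → w ^ℚ 2 * (1ℚ + 1ℚ) ≡ w * (w + w)
    rearrange = solve 1 (λ w → (w :* (w :* con 1ℚ)) :* (con 1ℚ :+ con 1ℚ) := w :* (w :+ w)) refl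

  layer-weight : ∀ {n w c} t → 0ℚ ≤ w → fromℕ n * w ≡ 1ℚ → c ℕ.≤ n ℕ.^ (2 ℕ.* t ℕ.+ 7) →
                 w ^ℚ (9 ℕ.+ 3 ℕ.* t) * fromℕ c ≤ w ^ℚ 2 * w ^ℚ t
  layer-weight {n} {w} {c} t 0≤w nw≡1 c≤nᵉ = begin
    w ^ℚ (9 ℕ.+ 3 ℕ.* t) * fromℕ c
      ≤⟨ *-monoˡ-≤-0≤ (^ℚ-nonneg (9 ℕ.+ 3 ℕ.* t) 0≤w) (fromℕ-mono-≤ c≤nᵉ) ⟩
    w ^ℚ (9 ℕ.+ 3 ℕ.* t) * fromℕ (n ℕ.^ e)
      ≡⟨ cong₂ (λ a b → w ^ℚ a * b) (exponent t) (fromℕ-^ n e) ⟨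
    w ^ℚ ((2 ℕ.+ t) ℕ.+ e) * N ^ℚ e
      ≡⟨ cong (_* N ^ℚ e) (^ℚ-+ w (2 ℕ.+ t) e) ⟩
    w ^ℚ (2 ℕ.+ t) * w ^ℚ e * N ^ℚ e
      ≡⟨ *-assoc (w ^ℚ (2 ℕ.+ t)) (w ^ℚ e) (N ^ℚ e) ⟩
    w ^ℚ (2 ℕ.+ t) * (w ^ℚ e * N ^ℚ e)
      ≡⟨ cong (w ^ℚ (2 ℕ.+ t) *_) (^ℚ-inverse e (trans (*-comm w N) nw≡1)) ⟩
    w ^ℚ (2 ℕ.+ t) * 1ℚ
      ≡⟨ trans (*-identityʳ _) (^ℚ-+ w 2 t) ⟩
    w ^ℚ 2 * w ^ℚ t ∎
    where
    open ≤-Reasoning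
    N : ℚ
    N = fromℕ n
    e : ℕ
    e = 2 ℕ.* t ℕ.+ 7
    exponent : ∀ t → (2 ℕ.+ t) ℕ.+ (2 ℕ.* t ℕ.+ 7) ≡ 9 ℕ.+ 3 ℕ.* t
    exponent = solve-∀

  far-cuts-weight : ∀ {n} (G : Multigraph n) → 2 ℕ.≤ n → ∀ {l} .{{_ : NonZero l}} → CutsAtLeast G l →
                    ∀ {p w} → 0ℚ ≤ p → p ≤ 1ℚ → 0ℚ ≤ w → fromℕ n * w ≡ 1ℚ → p ^ℚ l ≤ w ^ℚ 1000 →
                    ∑[ S ∈ filterᵇ (not ∘ isNearMinCut G l) (cutSides n) ] p ^ℚ cutSize G S ≤ p ^ℚ l * w
  far-cuts-weight {n} G 2≤n {l} cuts≥l {p} {w} 0≤p p≤1 0≤w nw≡1 pˡ≤w¹⁰⁰⁰ = begin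
    ∑[ S ∈ farCuts ] p ^ℚ cutSize G S
      ≤⟨ ∑-mono-filterᵇ isFar (cutSides n)
           (λ S → far-cut-weight {l = l} {k = cutSize G S} 0≤p p≤1 0≤w w≤1 pˡ≤w¹⁰⁰⁰ ∘ not-<ᵇ⇒≥) ⟩
    ∑[ S ∈ farCuts ] q * g (level l (cutSize G S))
      ≡⟨ *-distribˡ-∑ q farCuts _ ⟨
    q * (∑[ S ∈ farCuts ] g (level l (cutSize G S)))
      ≤⟨ *-monoˡ-≤-0≤ 0≤q (layer-cake farCuts (level l ∘ cutSize G) g L 0≤g level<L) ⟩
    q * (∑[ t ∈ upTo L ] g t * fromℕ (ℕ∑.∑[ S ∈ farCuts ] fromBool (level l (cutSize G S) ≤ᵇ t)))
      ≤⟨ *-monoˡ-≤-0≤ 0≤q (∑-mono (upTo L) (λ t →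
           layer-weight t 0≤w nw≡1 (levelCount-bound G 2≤n cuts≥l isFar t))) ⟩
    q * (∑[ t ∈ upTo L ] w ^ℚ 2 * w ^ℚ t)
      ≤⟨ *-monoˡ-≤-0≤ 0≤q (∑w²wᵗ≤w L 0≤w w+w≤1) ⟩
    q * w ∎
    where
    open ≤-Reasoning
    isFar : Vec Bool n → Bool
    isFar = not ∘ isNearMinCut G l
    farCuts : List (Vec Bool n)
    farCuts = filterᵇ isFar (cutSides n)
    q : ℚ
    q = p ^ℚ l
    0≤q : 0ℚ ≤ q
    0≤q = ^ℚ-nonneg l 0≤p
    w+w≤1 : w + w ≤ 1ℚ
    w+w≤1 = n*w≡1⇒w+w≤1 2≤n 0≤w nw≡1
    w≤1 : w ≤ 1ℚ
    w≤1 = ≤-trans (subst (_≤ w + w) (+-identityʳ w) (+-monoʳ-≤ w 0≤w)) w+w≤1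
    g : ℕ → ℚ
    g t = w ^ℚ (9 ℕ.+ 3 ℕ.* t)
    0≤g : ∀ t → 0ℚ ≤ g t
    0≤g t = ^ℚ-nonneg (9 ℕ.+ 3 ℕ.* t) 0≤w
    L : ℕ
    L = suc (2 ℕ.* length (edges G))
    level<L : ∀ S → level l (cutSize G S) ℕ.< L
    level<L S = ℕ.s≤s (ℕ.≤-trans (level≤2k l (cutSize G S)) (ℕ.*-monoʳ-≤ 2 (length-filter _ (edges G))))

  1≤fromℕ^ : ∀ n .{{_ : NonZero n}} k → 1ℚ ≤ fromℕ n ^ℚ k
  1≤fromℕ^ n k = subst (1ℚ ≤_) (sym (fromℕ-^ n k)) (fromℕ-mono-≤ (ℕ.m^n>0 n k))

  *^ℚ≤1⇒≤^ℚ : ∀ {x y w} k → 0ℚ ≤ w → y * w ≡ 1ℚ → x * y ^ℚ k ≤ 1ℚ → x ≤ w ^ℚ k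
  *^ℚ≤1⇒≤^ℚ {x} {y} {w} k 0≤w yw≡1 xyᵏ≤1 = begin
    x                          ≡⟨ *-identityʳ x ⟨
    x * 1ℚ                     ≡⟨ cong (x *_) (^ℚ-inverse k yw≡1) ⟨
    x * (y ^ℚ k * w ^ℚ k)      ≡⟨ *-assoc x _ _ ⟨
    x * y ^ℚ k * w ^ℚ k        ≤⟨ *-monoʳ-≤-0≤ (^ℚ-nonneg k 0≤w) xyᵏ≤1 ⟩
    1ℚ * w ^ℚ k                ≡⟨ *-identityˡ _ ⟩
    w ^ℚ k                     ∎
    where open ≤-Reasoning

  z-split : ∀ {n} (G : Multigraph n) l p →
            z G p ≡ z′ G l p + (∑[ S ∈ filterᵇ (not ∘ isNearMinCut G l) (cutSides n) ] p ^ℚ cutSize G S)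
  z-split {n} G l p = begin
    z G p                            ≡⟨ sumℚ-map (cutSides n) f ⟩
    ∑ (cutSides n) f                 ≡⟨ ∑-partition (isNearMinCut G l) (cutSides n) f ⟩
    ∑ nearCuts f + ∑ farCuts f       ≡⟨ cong (λ near → near + ∑ farCuts f) (sumℚ-map nearCuts f) ⟨
    z′ G l p + ∑ farCuts f           ∎
    where
    open ≡-Reasoning
    f : Vec Bool n → ℚ
    f S = p ^ℚ cutSize G S
    nearCuts farCuts : List (Vec Bool n)
    nearCuts = filterᵇ (isNearMinCut G l) (cutSides n)
    farCuts = filterᵇ (not ∘ isNearMinCut G l) (cutSides n)

  cut≤z : ∀ {n} (G : Multigraph n) {p S} → 0ℚ ≤ p → S ∈ cutSides n → p ^ℚ cutSize G S ≤ z G p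
  cut≤z {n} G {p} {S} 0≤p S∈cuts =
    subst (p ^ℚ cutSize G S ≤_) (sym (sumℚ-map (cutSides n) (λ S → p ^ℚ cutSize G S)))
          (∑-∈ (cutSides n) (λ S → ^ℚ-nonneg (cutSize G S) 0≤p) S∈cuts)

  near-min-dominates : ∀ {x all near far} → all ≡ near + far → far ≤ all * x → (1ℚ - x) * all ≤ near
  near-min-dominates {x} {all} {near} {far} all≡near+far far≤all·x = begin
    (1ℚ - x) * all                   ≡⟨ cong ((1ℚ - x) *_) all≡near+far ⟩
    (1ℚ - x) * (near + far)          ≡⟨ expand x near far ⟩
    near + (far - (near + far) * x)  ≡⟨ cong (λ y → near + (far - y * x)) all≡near+far ⟨
    near + (far - all * x)           ≤⟨ +-monoʳ-≤ near (+-monoˡ-≤ (- (all * x)) far≤all·x) ⟩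
    near + (all * x - all * x)       ≡⟨ trans (cong (λ y → near + y) (+-inverseʳ (all * x))) (+-identityʳ near) ⟩
    near                             ∎
    where
    open ≤-Reasoning
    open +-*-Solver using (solve; _:=_; _:+_; _:-_; _:*_; con)
    expand : ∀ x a b → (1ℚ - x) * (a + b) ≡ a + (b - (a + b) * x)
    expand = solve 3 (λ x a b → (con 1ℚ :- x) :* (a :+ b) := a :+ (b :- (a :+ b) :* x)) refl

open import Data.Bool using (not)
open import Data.Empty using (⊥-elim)
open import Data.Integer using (+_)
open import Data.List using (filterᵇ)
open import Data.Nat using (ℕ; zero; suc; NonZero; s≤s; z≤n)
open import Data.Product using (Σ; _,_)
open import Data.Rational using (ℚ; 0ℚ; 1ℚ; _*_; _-_; _/_; _<_; _≤_)
open import Data.Rational.Properties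
  using (<⇒≤; <-irrefl; ≤-<-trans; *-identityˡ; nonNegative⁻¹; normalize-nonNeg; module ≤-Reasoning)
open import Function using (_∘_)
open import Relation.Binary.PropositionalEquality using (refl; cong; subst)
open CutCounting using (cutsAtLeast; isNearMinCut)
open CutWeights

lemma3p18 : Σ ℚ λ c →
    (n : ℕ) → .{{_ : NonZero n}} → (G : Multigraph n) → (λ′ : ℕ) → (p : ℚ) →
    Connected G → IsMinCut G λ′ →
    0ℚ < p → p < 1ℚ →
    (p ^ℚ λ′) * ((+ n / 1) ^ℚ 1000) < 1ℚ →
    (1ℚ - c * (+ 1 / n)) * z G p ≤ z′ G λ′ p
lemma3p18 = 1ℚ , main
  where
  main : (n : ℕ) → .{{_ : NonZero n}} → (G : Multigraph n) → (λ′ : ℕ) → (p : ℚ) →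
         Connected G → IsMinCut G λ′ → 0ℚ < p → p < 1ℚ → (p ^ℚ λ′) * ((+ n / 1) ^ℚ 1000) < 1ℚ →
         (1ℚ - 1ℚ * (+ 1 / n)) * z G p ≤ z′ G λ′ p
  main (suc zero) G l p _ ((_ , () , _) , _) _ _ _
  main n@(suc (suc _)) G zero p _ _ _ _ nᵏ<1 =
    ⊥-elim (<-irrefl refl (≤-<-trans (1≤fromℕ^ n 1000) (subst (_< 1ℚ) (*-identityˡ _) nᵏ<1)))
  main n@(suc (suc _)) G l@(suc _) p _ ((S₀ , S₀∈cuts , |S₀|≡l) , min≤cuts) 0<p p<1 pˡnᵏ<1 =
    near-min-dominates (z-split G l p) (begin
      ∑[ S ∈ filterᵇ (not ∘ isNearMinCut G l) (cutSides n) ] p ^ℚ cutSize G S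
        ≤⟨ far-cuts-weight G (s≤s (s≤s z≤n)) (cutsAtLeast G min≤cuts)
                           0≤p (<⇒≤ p<1) 0≤w (fromℕ*1/ n) pˡ≤w¹⁰⁰⁰ ⟩
      p ^ℚ l * w
        ≤⟨ *-monoʳ-≤-0≤ 0≤w (subst (λ k → p ^ℚ k ≤ z G p) |S₀|≡l (cut≤z G 0≤p S₀∈cuts)) ⟩
      z G p * w
        ≡⟨ cong (z G p *_) (*-identityˡ w) ⟨
      z G p * (1ℚ * w) ∎)
    where
    open ≤-Reasoning
    w : ℚ
    w = + 1 / n
    0≤p : 0ℚ ≤ p
    0≤p = <⇒≤ 0<p
    0≤w : 0ℚ ≤ w
    0≤w = nonNegative⁻¹ w {{normalize-nonNeg 1 n}}
    pˡ≤w¹⁰⁰⁰ : p ^ℚ l ≤ w ^ℚ 1000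
    pˡ≤w¹⁰⁰⁰ = *^ℚ≤1⇒≤^ℚ {y = fromℕ n} 1000 0≤w (fromℕ*1/ n) (<⇒≤ pˡnᵏ<1)
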